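{- Let $G$ be a graph with a rooted tree decomposition $(\mathcal{T},\{X_t\}_{t\in V(\mathcal{T})})$ as described in the context. For every bag $t$ let $W_t\subseteq X_t\setminus X_{p(t)}$ be a set of vertices, $Y_t\subseteq E_t$ a set of edges, and $(Z_t,\Gamma^*_t,\Delta^*_t)$ a triple with $Z_t\subseteq X_t$ and $\Gamma^*_t,\Delta^*_t\subseteq X_t\times X_t$; let $W=\bigcup_t W_t$ and $Y=\bigcup_t Y_t$. Then the triples satisfy the local connectivity definition, namely for every bag $t$ $$Z_t=\begin{cases}W_t & t=\mathrm{root}(\mathcal{T})\\ (Z_{p(t)}\cup W_t)\cap X_t & \text{otherwise,}\end{cases}\quad \Gamma^*_t=\begin{cases}\emptyset & t\text{ a leaf}\\ \mathrm{tc}^*_{Z_t}(\Gamma^*_{t'}\cup\Gamma^*_{t''}\cup Y_t)|_t & \text{otherwise,}\end{cases}\quad \Delta^*_t=\begin{cases}\Gamma^*_t & t=\mathrm{root}(\mathcal{T})\\ \mathrm{tc}^*_{Z_t}(\Delta^*_{p(t)}\cup\Gamma^*_t)|_t & \text{otherwise}\end{cases}$$ (where $t',t''$ are the children of a non-leaf $t$ and $p(t)$ is the parent of $t$), if and only if they satisfy the global connectivity definition, namely for every bag $t$ $$Z_t=W\cap X_t,\qquad \Gamma^*_t=\mathrm{tc}^*_W(Y\cap E_{\mathcal{T}_t})|_t,\qquad \Delta^*_t=\mathrm{tc}^*_W(Y)|_t.$$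
   Context: A tree decomposition of $G$ is a tree $\mathcal{T}$ with bags $X_t\subseteq V(G)$ such that every vertex lies in some bag, every edge has both endpoints in some bag, and for each vertex the nodes whose bags contain it induce a connected subtree. $\mathcal{T}$ is rooted at $\mathrm{root}(\mathcal{T})$, every non-leaf node has exactly two children, $\mathcal{T}_t$ is the subtree rooted at $t$, and for the root we set $X_{p(\mathrm{root}(\mathcal{T}))}=\emptyset$. An edge $uv$ appears in bag $t$ if $t$ is the topmost bag containing both $u$ and $v$; $E_t$ is the set of edges appearing in $t$, every leaf bag has $E_t=\emptyset$, and $E_{\mathcal{T}_t}=\bigcup_{s\in V(\mathcal{T}_t)}E_s$. Edge sets are regarded as sets of ordered pairs (an edge $uv$ giving $(u,v)$ and $(v,u)$). For a vertex set $Z$ and a set $S$ of pairs, $\mathrm{tc}^*_Z(S)$ is the set of pairs $(u,v)$ for which there exist $\ell\ge 0$ and $w_1,\dots,w_\ell\in Z$ such that, with $w_0=u$ and $w_{\ell+1}=v$, $(w_i,w_{i+1})\in S$ for all $0\le i\le\ell$ (i.e., there is a $u$–$v$ path using pairs of $S$ whose internal vertices lie in $Z$). The projection $\Lambda|_t$ is $\Lambda\cap(X_t\times X_t)$. -}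

module Defs where

open import Data.Nat using (ℕ)
open import Data.Fin using (Fin)
open import Data.Fin.Subset using (Subset; _∈_; _∉_; _∪_; _∩_)
open import Data.Product using (Σ; ∃; _×_; _,_)
open import Data.Sum using (_⊎_)
open import Data.Empty using (⊥)
open import Relation.Nullary using (¬_)
open import Relation.Binary.PropositionalEquality using (_≡_; _≢_)

-- Finite simple graphs on vertex set Fin n; edges as ordered pairs
-- (an edge uv gives both (u,v) and (v,u)).

Rel : ℕ → Set₁
Rel n = Fin n → Fin n → Set

record SimpleGraph (n : ℕ) : Set₁ where
  field
    E       : Rel n
    E-sym   : ∀ u v → E u v → E v u
    E-irrefl : ∀ v → ¬ E v v

data Tree : Set where
  leaf : Tree
  node : Tree → Tree → Tree

data Pos : Tree → Set where
  here : ∀ {T} → Pos T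
  goL  : ∀ {l r} → Pos l → Pos (node l r)
  goR  : ∀ {l r} → Pos r → Pos (node l r)

root : ∀ {T} → Pos T
root = here

-- ChildOf c t : c is a child of t (i.e. t = p(c))
data ChildOf : ∀ {T} → Pos T → Pos T → Set where
  cL  : ∀ {l r} → ChildOf (goL {l} {r} here) here
  cR  : ∀ {l r} → ChildOf (goR {l} {r} here) here
  inL : ∀ {l r} {c t : Pos l} → ChildOf c t → ChildOf (goL {l} {r} c) (goL t)
  inR : ∀ {l r} {c t : Pos r} → ChildOf c t → ChildOf (goR {l} {r} c) (goR t)

IsLeaf : ∀ {T} → Pos T → Set
IsLeaf {T} t = ∀ (c : Pos T) → ¬ ChildOf c t

-- Desc s t : s is a node of the subtree 𝒯_t rooted at t
data Desc {T : Tree} : Pos T → Pos T → Set where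
  dRefl : ∀ {t} → Desc t t
  dStep : ∀ {s u t} → ChildOf s u → Desc u t → Desc s t

StrictAnc : ∀ {T} → Pos T → Pos T → Set
StrictAnc {T} a t = Σ (Pos T) λ u → ChildOf t u × Desc u a

Adj : ∀ {T} → Pos T → Pos T → Set
Adj s t = ChildOf s t ⊎ ChildOf t s

data Conn {T : Tree} (P : Pos T → Set) : Pos T → Pos T → Set where
  start : ∀ {s} → P s → Conn P s s
  step  : ∀ {s t u} → Conn P s t → Adj t u → P u → Conn P s u

module _ {n : ℕ} (G : SimpleGraph n) {T : Tree} (X : Pos T → Subset n) where
  open SimpleGraph G

  Appears : Pos T → Rel n
  Appears t u v = E u v × u ∈ X t × v ∈ X t
                  × (∀ a → StrictAnc a t → ¬ (u ∈ X a × v ∈ X a))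

  EdgesBelow : Pos T → Rel n
  EdgesBelow t u v = Σ (Pos T) λ s → Desc s t × Appears s u v

  record IsTreeDecomposition : Set where
    field
      vertexCovered : ∀ v → ∃ λ t → v ∈ X t
      edgeCovered   : ∀ u v → E u v → ∃ λ t → u ∈ X t × v ∈ X t
      connected     : ∀ v s t → v ∈ X s → v ∈ X t → Conn (λ r → v ∈ X r) s t
      leafNoEdges   : ∀ t → IsLeaf t → ∀ u v → ¬ Appears t u v

-- tc*_Z(S): (u,v) joined by an S-path whose internal vertices lie in Z
data TC {n : ℕ} (Z : Fin n → Set) (S : Rel n) : Rel n where
  one  : ∀ {u v} → S u v → TC Z S u v
  cons : ∀ {u w v} → S u w → Z w → TC Z S w v → TC Z S u v

_∪ᴿ_ : ∀ {n} → Rel n → Rel n → Rel n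
(R ∪ᴿ S) u v = R u v ⊎ S u v

_∩ᴿ_ : ∀ {n} → Rel n → Rel n → Rel n
(R ∩ᴿ S) u v = R u v × S u v

∅ᴿ : ∀ {n} → Rel n
∅ᴿ _ _ = ⊥

proj : ∀ {n} → Subset n → Rel n → Rel n
proj Xt R u v = R u v × u ∈ Xt × v ∈ Xt

_≐ᴿ_ : ∀ {n} → Rel n → Rel n → Set
R ≐ᴿ S = ∀ u v → (R u v → S u v) × (S u v → R u v)

_≐ⱽ_ : ∀ {n} → Subset n → (Fin n → Set) → Set
A ≐ⱽ P = ∀ v → (v ∈ A → P v) × (P v → v ∈ A)

module _ {n : ℕ} {T : Tree} (X : Pos T → Subset n)
         (W : Pos T → Subset n) (Y : Pos T → Rel n)
         (Z : Pos T → Subset n) (Γ Δ : Pos T → Rel n) where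

  LocalConn : Set
  LocalConn =
      (∀ t → (t ≡ root → Z t ≐ⱽ (λ v → v ∈ W t))
           × (∀ p → ChildOf t p → Z t ≐ⱽ (λ v → v ∈ ((Z p ∪ W t) ∩ X t))))
    × (∀ t → (IsLeaf t → Γ t ≐ᴿ ∅ᴿ)
           × (∀ t' t'' → ChildOf t' t → ChildOf t'' t → t' ≢ t'' →
                Γ t ≐ᴿ proj (X t) (TC (λ w → w ∈ Z t) ((Γ t' ∪ᴿ Γ t'') ∪ᴿ Y t))))
    × (∀ t → (t ≡ root → Δ t ≐ᴿ Γ t)
           × (∀ p → ChildOf t p →
                Δ t ≐ᴿ proj (X t) (TC (λ w → w ∈ Z t) (Δ p ∪ᴿ Γ t))))

Wall : ∀ {n} {T : Tree} → (Pos T → Subset n) → Fin n → Set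
Wall {T = T} W v = Σ (Pos T) λ t → v ∈ W t

Yall : ∀ {n} {T : Tree} → (Pos T → Rel n) → Rel n
Yall {T = T} Y u v = Σ (Pos T) λ t → Y t u v

module _ {n : ℕ} (G : SimpleGraph n) {T : Tree} (X : Pos T → Subset n)
         (W : Pos T → Subset n) (Y : Pos T → Rel n)
         (Z : Pos T → Subset n) (Γ Δ : Pos T → Rel n) where

  GlobalConn : Set
  GlobalConn =
      (∀ t → Z t ≐ⱽ (λ v → Wall W v × v ∈ X t))
    × (∀ t → Γ t ≐ᴿ proj (X t) (TC (Wall W)
                                   (Yall Y ∩ᴿ EdgesBelow G X t)))
    × (∀ t → Δ t ≐ᴿ proj (X t) (TC (Wall W) (Yall Y)))

module Submission where

-- The global quantities Zᵍ_t = W ∩ X_t, Γᵍ_t = tc*_W(Y ∩ E_{𝒯_t})|_t and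
-- Δᵍ_t = tc*_W(Y)|_t satisfy the local recursions.  The heart of this is a
-- path-splitting argument: a W-path between two vertices of X_t is cut at its
-- vertices in X_t, and each resulting segment has all inner vertices outside
-- X_t.  By the connectivity of the decomposition such a segment is confined to
-- one side of the separator X_t: either it is a single edge appearing at t, or
-- it lives below one child of t (giving a Γ-pair of that child), or, for Δ,
-- it lives outside 𝒯_t (giving a Δ-pair of the parent).

open import Defs
open import Data.Nat using (ℕ)
open import Data.Fin using (Fin)
open import Data.Fin.Subset using (Subset; _∈_; _∉_; _∪_; _∩_)
open import Data.Fin.Subset.Properties using (_∈?_; x∈p∪q⁻; x∈p∪q⁺; x∈p∩q⁻; x∈p∩q⁺)
open import Data.Product using (Σ; _×_; _,_; proj₁; proj₂)
open import Data.Sum using (_⊎_; inj₁; inj₂)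
import Data.Sum as Sum
open import Data.Empty using (⊥; ⊥-elim)
open import Data.Unit using (⊤; tt)
open import Function using (id)
open import Relation.Nullary using (¬_; Dec; yes; no)
open import Relation.Nullary.Decidable using (map′)
open import Relation.Unary using (Decidable)
open import Relation.Binary.PropositionalEquality using (_≡_; _≢_; refl; cong; subst)

-- The structural descendant order: s ≼ t iff the address of t is a prefix of
-- the address of s.  It makes decidability and antisymmetry of Desc immediate.
_≼_ : ∀ {T} → Pos T → Pos T → Set
_     ≼ here  = ⊤
here  ≼ goL _ = ⊥
here  ≼ goR _ = ⊥
goL s ≼ goL t = s ≼ t
goR s ≼ goR t = s ≼ t
goL _ ≼ goR _ = ⊥
goR _ ≼ goL _ = ⊥

_≼?_ : ∀ {T} (s t : Pos T) → Dec (s ≼ t)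
_     ≼? here  = yes tt
here  ≼? goL _ = no λ ()
here  ≼? goR _ = no λ ()
goL s ≼? goL t = s ≼? t
goR s ≼? goR t = s ≼? t
goL _ ≼? goR _ = no λ ()
goR _ ≼? goL _ = no λ ()

≼-refl : ∀ {T} (s : Pos T) → s ≼ s
≼-refl here    = tt
≼-refl (goL s) = ≼-refl s
≼-refl (goR s) = ≼-refl s

≼-child : ∀ {T} {s u t : Pos T} → ChildOf s u → u ≼ t → s ≼ t
≼-child {t = here}  _        _ = tt
≼-child {t = goL t} (inL ch) d = ≼-child {t = t} ch d
≼-child {t = goR t} (inR ch) d = ≼-child {t = t} ch d

≼-antisym : ∀ {T} {s t : Pos T} → s ≼ t → t ≼ s → s ≡ t
≼-antisym {s = here}  {here}  _ _ = refl
≼-antisym {s = goL s} {goL t} a b = cong goL (≼-antisym a b)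
≼-antisym {s = goR s} {goR t} a b = cong goR (≼-antisym a b)

parent⋠child : ∀ {T} {c t : Pos T} → ChildOf c t → ¬ (t ≼ c)
parent⋠child (inL ch) d = parent⋠child ch d
parent⋠child (inR ch) d = parent⋠child ch d

Desc-trans : ∀ {T} {s u t : Pos T} → Desc s u → Desc u t → Desc s t
Desc-trans dRefl        b = b
Desc-trans (dStep ch a) b = dStep ch (Desc-trans a b)

Desc-goL : ∀ {l r} {s t : Pos l} → Desc s t → Desc (goL {l} {r} s) (goL t)
Desc-goL dRefl        = dRefl
Desc-goL (dStep ch d) = dStep (inL ch) (Desc-goL d)

Desc-goR : ∀ {l r} {s t : Pos r} → Desc s t → Desc (goR {l} {r} s) (goR t)
Desc-goR dRefl        = dRefl
Desc-goR (dStep ch d) = dStep (inR ch) (Desc-goR d)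

Desc-root : ∀ {T} (s : Pos T) → Desc s root
Desc-root here    = dRefl
Desc-root (goL s) = Desc-trans (Desc-goL (Desc-root s)) (dStep cL dRefl)
Desc-root (goR s) = Desc-trans (Desc-goR (Desc-root s)) (dStep cR dRefl)

Desc⇒≼ : ∀ {T} {s t : Pos T} → Desc s t → s ≼ t
Desc⇒≼ {s = s} dRefl        = ≼-refl s
Desc⇒≼ {t = t} (dStep ch d) = ≼-child {t = t} ch (Desc⇒≼ d)

≼⇒Desc : ∀ {T} {s t : Pos T} → s ≼ t → Desc s t
≼⇒Desc {s = s}     {t = here}  _ = Desc-root s
≼⇒Desc {s = goL s} {t = goL t} d = Desc-goL (≼⇒Desc d)
≼⇒Desc {s = goR s} {t = goR t} d = Desc-goR (≼⇒Desc d)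

Desc? : ∀ {T} (s t : Pos T) → Dec (Desc s t)
Desc? s t = map′ ≼⇒Desc Desc⇒≼ (s ≼? t)

Desc-antisym : ∀ {T} {s t : Pos T} → Desc s t → Desc t s → s ≡ t
Desc-antisym a b = ≼-antisym (Desc⇒≼ a) (Desc⇒≼ b)

parentNotDesc : ∀ {T} {c t : Pos T} → ChildOf c t → ¬ Desc t c
parentNotDesc ch d = parent⋠child ch (Desc⇒≼ d)

parentUnique : ∀ {T} {c p q : Pos T} → ChildOf c p → ChildOf c q → p ≡ q
parentUnique cL      cL      = refl
parentUnique cR      cR      = refl
parentUnique (inL a) (inL b) = cong goL (parentUnique a b)
parentUnique (inR a) (inR b) = cong goR (parentUnique a b)

rootOrChild : ∀ {T} (s : Pos T) → s ≡ root ⊎ Σ (Pos T) (ChildOf s)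
rootOrChild here = inj₁ refl
rootOrChild (goL s) with rootOrChild s
... | inj₁ refl     = inj₂ (here , cL)
... | inj₂ (p , ch) = inj₂ (goL p , inL ch)
rootOrChild (goR s) with rootOrChild s
... | inj₁ refl     = inj₂ (here , cR)
... | inj₂ (p , ch) = inj₂ (goR p , inR ch)

descTop : ∀ {T} {s t : Pos T} → Desc s t → s ≡ t ⊎ Σ (Pos T) λ c → ChildOf c t × Desc s c
descTop dRefl = inj₁ refl
descTop {s = s} (dStep ch d) with descTop d
... | inj₁ refl           = inj₂ (s , ch , dRefl)
... | inj₂ (c , ch' , d') = inj₂ (c , ch' , dStep ch d')

HasTwoChildren : ∀ {T} → Pos T → Set
HasTwoChildren {T} t = Σ (Pos T) λ a → Σ (Pos T) λ b → ChildOf a t × ChildOf b t × a ≢ b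

leafOrTwo : ∀ {T} (t : Pos T) → IsLeaf t ⊎ HasTwoChildren t
leafOrTwo {leaf}     here = inj₁ λ _ ()
leafOrTwo {node l r} here = inj₂ (goL here , goR here , cL , cR , λ ())
leafOrTwo {node l r} (goL x) with leafOrTwo x
... | inj₁ lf = inj₁ λ { (goL c) (inL ch) → lf c ch }
... | inj₂ (a , b , ca , cb , ne) = inj₂ (goL a , goL b , inL ca , inL cb , λ { refl → ne refl })
leafOrTwo {node l r} (goR x) with leafOrTwo x
... | inj₁ lf = inj₁ λ { (goR c) (inR ch) → lf c ch }
... | inj₂ (a , b , ca , cb , ne) = inj₂ (goR a , goR b , inR ca , inR cb , λ { refl → ne refl })

oneOfTwoChildren : ∀ {T} {c a b t : Pos T} → ChildOf c t → ChildOf a t → ChildOf b t → a ≢ b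
                 → c ≡ a ⊎ c ≡ b
oneOfTwoChildren cL cL _  _  = inj₁ refl
oneOfTwoChildren cR cR _  _  = inj₁ refl
oneOfTwoChildren cL cR cL _  = inj₂ refl
oneOfTwoChildren cR cL cR _  = inj₂ refl
oneOfTwoChildren cL cR cR ne = ⊥-elim (ne refl)
oneOfTwoChildren cR cL cL ne = ⊥-elim (ne refl)
oneOfTwoChildren (inL x) (inL y) (inL z) ne
  with oneOfTwoChildren x y z (λ { refl → ne refl })
... | inj₁ refl = inj₁ refl
... | inj₂ refl = inj₂ refl
oneOfTwoChildren (inR x) (inR y) (inR z) ne
  with oneOfTwoChildren x y z (λ { refl → ne refl })
... | inj₁ refl = inj₁ refl
... | inj₂ refl = inj₂ refl

topDown : ∀ {T} (Q : Pos T → Set) → Q root → (∀ {c p} → ChildOf c p → Q p → Q c) → ∀ t → Q t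
topDown Q qr next here = qr
topDown {node l r} Q qr next (goL x) =
  topDown {l} (λ y → Q (goL y)) (next cL qr) (λ ch → next (inL ch)) x
topDown {node l r} Q qr next (goR x) =
  topDown {r} (λ y → Q (goR y)) (next cR qr) (λ ch → next (inR ch)) x

bottomUp : ∀ {T} (Q : Pos T → Set) → (∀ t → (∀ c → ChildOf c t → Q c) → Q t) → ∀ t → Q t
bottomUp {leaf} Q next here = next here λ _ ()
bottomUp {node l r} Q next = go
  where
  left : ∀ x → Q (goL x)
  left = bottomUp {l} (λ y → Q (goL y)) λ x ih → next (goL x) λ { (goL c) (inL ch) → ih c ch }
  right : ∀ x → Q (goR x)
  right = bottomUp {r} (λ y → Q (goR y)) λ x ih → next (goR x) λ { (goR c) (inR ch) → ih c ch }
  go : ∀ t → Q t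
  go here    = next here λ { (goL here) cL → left here ; (goR here) cR → right here }
  go (goL x) = left x
  go (goR x) = right x

connStart : ∀ {T} {P : Pos T → Set} {a b} → Conn P a b → P a
connStart (start p)    = p
connStart (step w _ _) = connStart w

walkStaysBelowChild : ∀ {T} {P : Pos T → Set} {a b c p} → ChildOf c p → ¬ P p
                    → Conn P a b → Desc a c → Desc b c
walkStaysBelowChild cp np (start _) d = d
-- a step down keeps the walk in 𝒯_c; a step up from c would reach its parent
walkStaysBelowChild cp np (step w (inj₂ down) _) d = dStep down (walkStaysBelowChild cp np w d)
walkStaysBelowChild cp np (step w (inj₁ up) pu) d with walkStaysBelowChild cp np w d
... | dRefl with parentUnique up cp
...   | refl = ⊥-elim (np pu)
walkStaysBelowChild cp np (step w (inj₁ up) pu) d | dStep ch d' with parentUnique up ch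
...   | refl = d'

walkStaysBelow : ∀ {T} {P : Pos T → Set} {a b t} → ¬ P t → Conn P a b → Desc a t → Desc b t
walkStaysBelow nt w d with descTop d
... | inj₁ refl           = ⊥-elim (nt (connStart w))
... | inj₂ (c , ch , dc) = Desc-trans (walkStaysBelowChild ch nt w dc) (dStep ch dRefl)

module _ {n : ℕ} where

  tcAppend : ∀ {Z : Fin n → Set} {S : Rel n} {u w v} → TC Z S u w → Z w → TC Z S w v → TC Z S u v
  tcAppend (one s)       z q = cons s z q
  tcAppend (cons s z' p) z q = cons s z' (tcAppend p z q)

  tcMono : ∀ {Z Z' : Fin n → Set} {S S' : Rel n} → (∀ {w} → Z w → Z' w) → (∀ {a b} → S a b → S' a b)
         → ∀ {u v} → TC Z S u v → TC Z' S' u v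
  tcMono f g (one s)      = one (g s)
  tcMono f g (cons s z p) = cons (g s) (f z) (tcMono f g p)

  tcFlatten : ∀ {Z Z' : Fin n → Set} {R S : Rel n} → (∀ {w} → Z w → Z' w)
            → (∀ {a b} → R a b → TC Z' S a b) → ∀ {u v} → TC Z R u v → TC Z' S u v
  tcFlatten f g (one r)      = g r
  tcFlatten f g (cons r z p) = tcAppend (g r) (f z) (tcFlatten f g p)

  tcMapOn : ∀ {Z P : Fin n → Set} {S S' : Rel n} → (∀ {w} → Z w → P w)
          → (∀ {a b} → P a → P b → S a b → S' a b)
          → ∀ {u v} → P u → P v → TC Z S u v → TC Z S' u v
  tcMapOn inv f pu pv (one s)      = one (f pu pv s)
  tcMapOn inv f pu pv (cons s z p) = cons (f pu (inv z) s) z (tcMapOn inv f (inv z) pv p)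

  splitAt : ∀ {Z P : Fin n → Set} {S : Rel n} → Decidable P → ∀ {u v} → TC Z S u v
          → TC (λ w → Z w × P w) (TC (λ w → Z w × ¬ P w) S) u v
  splitAt P? (one s) = one (one s)
  splitAt {Z} {P} {S} P? (cons {u} {w} s z p) with P? w
  ... | yes pw = cons (one s) (z , pw) (splitAt P? p)
  ... | no npw = prepend (splitAt P? p)
    where
    prepend : ∀ {v} → TC (λ w → Z w × P w) (TC (λ w → Z w × ¬ P w) S) w v
            → TC (λ w → Z w × P w) (TC (λ w → Z w × ¬ P w) S) u v
    prepend (one seg)          = one (cons s (z , npw) seg)
    prepend (cons seg zw rest) = cons (cons s (z , npw) seg) zw rest

module _ {n : ℕ} where

  ≐-refl : {A : Rel n} → A ≐ᴿ A
  ≐-refl u v = id , id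

  ≐-sym : {A B : Rel n} → A ≐ᴿ B → B ≐ᴿ A
  ≐-sym p u v = proj₂ (p u v) , proj₁ (p u v)

  ≐-trans : {A B C : Rel n} → A ≐ᴿ B → B ≐ᴿ C → A ≐ᴿ C
  ≐-trans p q u v = (λ x → proj₁ (q u v) (proj₁ (p u v) x)) , (λ x → proj₂ (p u v) (proj₂ (q u v) x))

  ∪-cong : {A B C D : Rel n} → A ≐ᴿ B → C ≐ᴿ D → (A ∪ᴿ C) ≐ᴿ (B ∪ᴿ D)
  ∪-cong p q u v = Sum.map (proj₁ (p u v)) (proj₁ (q u v)) , Sum.map (proj₂ (p u v)) (proj₂ (q u v))

  _≃_ : (Fin n → Set) → (Fin n → Set) → Set
  P ≃ Q = ∀ v → (P v → Q v) × (Q v → P v)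

  ≃-sym : {P Q : Fin n → Set} → P ≃ Q → Q ≃ P
  ≃-sym p v = proj₂ (p v) , proj₁ (p v)

  ≃-trans : {P Q R : Fin n → Set} → P ≃ Q → Q ≃ R → P ≃ R
  ≃-trans p q v = (λ x → proj₁ (q v) (proj₁ (p v) x)) , (λ x → proj₂ (p v) (proj₂ (q v) x))

  projTC-cong : {Xt : Subset n} {Z Z' : Fin n → Set} {S S' : Rel n} → Z ≃ Z' → S ≐ᴿ S'
              → proj Xt (TC Z S) ≐ᴿ proj Xt (TC Z' S')
  projTC-cong zz ss u v =
      (λ { (p , a , b) → tcMono (λ {w} → proj₁ (zz w)) (λ {a} {b} → proj₁ (ss a b)) p , a , b })
    , (λ { (p , a , b) → tcMono (λ {w} → proj₂ (zz w)) (λ {a} {b} → proj₂ (ss a b)) p , a , b })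

  ∈∪∩ : (A B C : Subset n) {P : Fin n → Set} → (λ v → v ∈ A) ≃ P
      → (λ v → v ∈ (A ∪ B) ∩ C) ≃ (λ v → (P v ⊎ v ∈ B) × v ∈ C)
  ∈∪∩ A B C e v =
      (λ m → let (x , y) = x∈p∩q⁻ (A ∪ B) C m in Sum.map (proj₁ (e v)) id (x∈p∪q⁻ A B x) , y)
    , (λ { (x , y) → x∈p∩q⁺ (x∈p∪q⁺ (Sum.map (proj₂ (e v)) id x) , y) })

module Bags {n : ℕ} (G : SimpleGraph n) {T : Tree} (X : Pos T → Subset n)
            (td : IsTreeDecomposition G X) where

  open IsTreeDecomposition td

  Confined : (Pos T → Set) → Fin n → Set
  Confined Q v = ∀ {s s'} → v ∈ X s → Q s → v ∈ X s' → Q s'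

  AppearsWithin : (Pos T → Set) → Rel n
  AppearsWithin Q a b = Σ (Pos T) λ s → Q s × Appears G X s a b

  confinedBelowChild : ∀ {c p v} → ChildOf c p → v ∉ X p → Confined (λ s → Desc s c) v
  confinedBelowChild ch np vs d vs' = walkStaysBelowChild ch np (connected _ _ _ vs vs') d

  confinedBelow : ∀ {t v} → v ∉ X t → Confined (λ s → Desc s t) v
  confinedBelow nt vs d vs' = walkStaysBelow nt (connected _ _ _ vs vs') d

  confinedOutside : ∀ {t v} → v ∉ X t → Confined (λ s → ¬ Desc s t) v
  confinedOutside nt vs nd vs' d' = nd (confinedBelow nt vs' d' vs)

  enterChild : ∀ {c t s v} → ChildOf c t → v ∈ X s → Desc s c → v ∈ X t → v ∈ X c
  enterChild {c = c} {v = v} ch vs d vt with v ∈? X c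
  ... | yes vc  = vc
  ... | no nvc = ⊥-elim (parentNotDesc ch (confinedBelow nvc vs d vt))

  exitToParent : ∀ {t p s v} → ChildOf t p → v ∈ X s → ¬ Desc s t → v ∈ X t → v ∈ X p
  exitToParent {p = p} {v = v} ch vs nd vt with v ∈? X p
  ... | yes vp  = vp
  ... | no nvp = ⊥-elim (nd (confinedBelowChild ch nvp vt dRefl vs))

  appearsTopmost : ∀ {s a b r} → Appears G X s a b → a ∈ X r → b ∈ X r → Desc r s
  appearsTopmost {s} {a} {b} {r} (_ , as , bs , topmost) ar br with rootOrChild s
  ... | inj₁ refl = Desc-root r
  ... | inj₂ (q , ch) with a ∈? X q
  ...   | yes aq  = confinedBelowChild ch (λ bq → topmost q (q , ch , dRefl) (aq , bq)) bs dRefl br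
  ...   | no naq = confinedBelowChild ch naq as dRefl ar

  appearsUnique : ∀ {s s' a b} → Appears G X s a b → Appears G X s' a b → s ≡ s'
  appearsUnique app@(_ , as , bs , _) app'@(_ , as' , bs' , _) =
    Desc-antisym (appearsTopmost app' as bs) (appearsTopmost app as' bs')

  targetBag : ∀ {Z : Fin n → Set} {R : Rel n} {Q a b}
            → TC Z (R ∩ᴿ AppearsWithin Q) a b → Σ (Pos T) λ s → Q s × b ∈ X s
  targetBag (one (_ , s , q , _ , _ , bs , _)) = s , q , bs
  targetBag (cons _ _ p)                       = targetBag p

module Global {n : ℕ} (G : SimpleGraph n) {T : Tree} (X : Pos T → Subset n)
              (td : IsTreeDecomposition G X)
              (W : Pos T → Subset n) (Y : Pos T → Rel n)
              (W⊆X : ∀ t v → v ∈ W t → v ∈ X t)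
              (W∉parent : ∀ t p → ChildOf t p → ∀ v → v ∈ W t → v ∉ X p)
              (Y-appears : ∀ t u v → Y t u v → Appears G X t u v) where

  open IsTreeDecomposition td
  open Bags G X td

  Wᵍ : Fin n → Set
  Wᵍ = Wall W

  Yᵍ : Rel n
  Yᵍ = Yall Y

  Zᵍ : Pos T → Fin n → Set
  Zᵍ t v = Wᵍ v × v ∈ X t

  Γᵍ : Pos T → Rel n
  Γᵍ t = proj (X t) (TC Wᵍ (Yᵍ ∩ᴿ EdgesBelow G X t))

  Δᵍ : Pos T → Rel n
  Δᵍ t = proj (X t) (TC Wᵍ Yᵍ)

  -- Vertices of W outside X_t, the inner vertices of segments at t.
  Outside : Pos T → Fin n → Set
  Outside t w = Wᵍ w × w ∉ X t

  wBagsBelow : ∀ {v s t} → v ∈ W s → v ∈ X t → Desc t s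
  wBagsBelow {v} {s} {t} w vt with rootOrChild s
  ... | inj₁ refl     = Desc-root t
  ... | inj₂ (q , ch) = confinedBelowChild ch (W∉parent s q ch v w) (W⊆X s v w) dRefl vt

  yAppears : ∀ {a b} (e : Yᵍ a b) → Appears G X (proj₁ e) a b
  yAppears {a} {b} (s , y) = Y-appears s a b y

  yNodeBelow : ∀ {t a b} (e : Yᵍ a b) → EdgesBelow G X t a b → Desc (proj₁ e) t
  yNodeBelow e (s , d , app) = subst (λ q → Desc q _) (appearsUnique app (yAppears e)) d

  headNode : ∀ {Z : Fin n → Set} {a b} → TC Z Yᵍ a b → Pos T
  headNode (one e)      = proj₁ e
  headNode (cons e _ _) = proj₁ e

  headSource : ∀ {Z : Fin n → Set} {a b} (p : TC Z Yᵍ a b) → a ∈ X (headNode p)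
  headSource (one e)      = proj₁ (proj₂ (yAppears e))
  headSource (cons e _ _) = proj₁ (proj₂ (yAppears e))

  confineWalk : ∀ {Z : Fin n → Set} {Q : Pos T → Set} → (∀ {w} → Z w → Confined Q w)
              → ∀ {a b} (p : TC Z Yᵍ a b) → Q (headNode p) → TC Z (Yᵍ ∩ᴿ AppearsWithin Q) a b
  confineWalk cf (one e) q = one (e , _ , q , yAppears e)
  confineWalk cf (cons e z rest) q =
    cons (e , _ , q , yAppears e) z
         (confineWalk cf rest (cf z (proj₁ (proj₂ (proj₂ (yAppears e)))) q (headSource rest)))

  module ΓRecursion {t t' t'' : Pos T} (c₁ : ChildOf t' t) (c₂ : ChildOf t'' t) (t'≢t'' : t' ≢ t'') where

    Segment : Rel n
    Segment = TC (Outside t) (Yᵍ ∩ᴿ EdgesBelow G X t)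

    forget : ∀ {a b} → Segment a b → TC (Outside t) Yᵍ a b
    forget = tcMono id proj₁

    headBelow : ∀ {a b} (p : Segment a b) → Desc (headNode (forget p)) t
    headBelow (one (e , eb))      = yNodeBelow e eb
    headBelow (cons (e , eb) _ _) = yNodeBelow e eb

    -- A segment whose first edge is a Y_t-edge is that single edge, since any
    -- further vertex would lie in X_t.
    headAtTop : ∀ {a b} (p : Segment a b) → headNode (forget p) ≡ t → Y t a b
    headAtTop (one (e , _)) eq = subst (λ s → Y s _ _) eq (proj₂ e)
    headAtTop (cons (e , _) (_ , w∉t) _) eq =
      ⊥-elim (w∉t (subst (λ s → _ ∈ X s) eq (proj₁ (proj₂ (proj₂ (yAppears e))))))

    -- A segment entering 𝒯_c stays there, so it is a Γ-pair of c.
    belowChild : ∀ {c a b} → ChildOf c t → (p : TC (Outside t) Yᵍ a b) → Desc (headNode p) c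
               → a ∈ X t → b ∈ X t → Γᵍ c a b
    belowChild ch p dc at bt =
      let q            = confineWalk (λ z → confinedBelowChild ch (proj₂ z)) p dc
          (s , ds , bs) = targetBag q
      in tcMono proj₁ id q , enterChild ch (headSource p) dc at , enterChild ch bs ds bt

    Step : Rel n
    Step = (Γᵍ t' ∪ᴿ Γᵍ t'') ∪ᴿ Y t

    fromChild : ∀ {c a b} → ChildOf c t → Γᵍ c a b → Step a b
    fromChild ch g with oneOfTwoChildren ch c₁ c₂ t'≢t''
    ... | inj₁ refl = inj₁ (inj₁ g)
    ... | inj₂ refl = inj₁ (inj₂ g)

    classify : ∀ {a b} → a ∈ X t → b ∈ X t → Segment a b → Step a b
    classify at bt p with descTop (headBelow p)
    ... | inj₁ eq            = inj₂ (headAtTop p eq)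
    ... | inj₂ (c , ch , dc) = fromChild ch (belowChild ch (forget p) dc at bt)

    stepPath : ∀ {a b} → Step a b → TC Wᵍ (Yᵍ ∩ᴿ EdgesBelow G X t) a b
    stepPath (inj₁ (inj₁ (g , _))) = tcMono id (λ { (e , s , d , app) → e , s , Desc-trans d (dStep c₁ dRefl) , app }) g
    stepPath (inj₁ (inj₂ (g , _))) = tcMono id (λ { (e , s , d , app) → e , s , Desc-trans d (dStep c₂ dRefl) , app }) g
    stepPath {a} {b} (inj₂ y)      = one ((t , y) , t , dRefl , Y-appears t a b y)

    Γ-recursion : Γᵍ t ≐ᴿ proj (X t) (TC (Zᵍ t) Step)
    Γ-recursion u v =
        (λ { (p , ut , vt) → tcMapOn proj₂ classify ut vt (splitAt (λ w → w ∈? X t) p) , ut , vt })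
      , (λ { (p , ut , vt) → tcFlatten proj₁ stepPath p , ut , vt })

  module ΔRecursion {t p : Pos T} (ch : ChildOf t p) where

    Step : Rel n
    Step = Δᵍ p ∪ᴿ Γᵍ t

    -- A segment starting in 𝒯_t stays in 𝒯_t (a Γ-pair of t); otherwise it
    -- stays outside 𝒯_t and its ends lie in X_{p(t)} (a Δ-pair of the parent).
    classify : ∀ {a b} → a ∈ X t → b ∈ X t → TC (Outside t) Yᵍ a b → Step a b
    classify at bt seg with Desc? (headNode seg) t
    ... | yes d = inj₂ (tcMono proj₁ id (confineWalk (λ z → confinedBelow (proj₂ z)) seg d) , at , bt)
    ... | no nd =
      let q             = confineWalk (λ z → confinedOutside (proj₂ z)) seg nd
          (s , ns , bs) = targetBag q
      in inj₁ (tcMono proj₁ proj₁ q , exitToParent ch (headSource seg) nd at , exitToParent ch bs ns bt)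

    stepPath : ∀ {a b} → Step a b → TC Wᵍ Yᵍ a b
    stepPath (inj₁ (g , _)) = g
    stepPath (inj₂ (g , _)) = tcMono id proj₁ g

    Δ-recursion : Δᵍ t ≐ᴿ proj (X t) (TC (Zᵍ t) Step)
    Δ-recursion u v =
        (λ { (q , ut , vt) → tcMapOn proj₂ classify ut vt (splitAt (λ w → w ∈? X t) q) , ut , vt })
      , (λ { (q , ut , vt) → tcFlatten proj₁ stepPath q , ut , vt })

  -- Every edge appears in 𝒯_root, so Δ and Γ agree at the root.
  Δ-root : Δᵍ root ≐ᴿ Γᵍ root
  Δ-root u v =
      (λ { (q , ut , vt) → tcMono id (λ e → e , proj₁ e , Desc-root _ , yAppears e) q , ut , vt })
    , (λ { (q , ut , vt) → tcMono id proj₁ q , ut , vt })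

  -- No edge appears in the subtree of a leaf.
  Γ-leaf : ∀ t → IsLeaf t → Γᵍ t ≐ᴿ ∅ᴿ
  Γ-leaf t lf u v = (λ { (q , _) → noEdge q }) , λ ()
    where
    noEdgeBelow : ∀ {a b} → EdgesBelow G X t a b → ⊥
    noEdgeBelow {a} {b} (s , d , app) with descTop d
    ... | inj₁ refl          = leafNoEdges t lf a b app
    ... | inj₂ (c , ch , _) = lf c ch
    noEdge : ∀ {a b} → TC Wᵍ (Yᵍ ∩ᴿ EdgesBelow G X t) a b → ⊥
    noEdge (one (_ , eb))      = noEdgeBelow eb
    noEdge (cons (_ , eb) _ _) = noEdgeBelow eb

  Z-root : (λ v → v ∈ W root) ≃ Zᵍ root
  Z-root v = (λ w → (root , w) , W⊆X root v w)
           , λ { ((s , w) , vr) → subst (λ q → v ∈ W q) (Desc-antisym (Desc-root s) (wBagsBelow w vr)) w }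

  -- A vertex of W in X_c but not in X_{p(c)} belongs to W_c.
  Z-child : ∀ {c p} → ChildOf c p → (λ v → (Zᵍ p v ⊎ v ∈ W c) × v ∈ X c) ≃ Zᵍ c
  Z-child {c} {p} ch v = there , back
    where
    there : (Zᵍ p v ⊎ v ∈ W c) × v ∈ X c → Zᵍ c v
    there (inj₁ (w , _) , vc) = w , vc
    there (inj₂ w , vc)       = (c , w) , vc
    back : Zᵍ c v → (Zᵍ p v ⊎ v ∈ W c) × v ∈ X c
    back ((s , w) , vc) with v ∈? X p
    ... | yes vp  = inj₁ ((s , w) , vp) , vc
    ... | no nvp = inj₂ (subst (λ q → v ∈ W q) sc w) , vc
      where
      sc : s ≡ c
      sc = Desc-antisym (confinedBelowChild ch nvp vc dRefl (W⊆X s v w)) (wBagsBelow w vc)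

-- The local right-hand sides, evaluated on data that agree with the global
-- quantities at the neighbouring nodes, agree with the global quantity at t.
-- This gives both directions: by induction from the local definition, and
-- directly from the global one.
module Equivalence {n : ℕ} (G : SimpleGraph n) {T : Tree} (X : Pos T → Subset n)
                   (td : IsTreeDecomposition G X)
                   (W : Pos T → Subset n) (Y : Pos T → Rel n)
                   (W⊆X : ∀ t v → v ∈ W t → v ∈ X t)
                   (W∉parent : ∀ t p → ChildOf t p → ∀ v → v ∈ W t → v ∉ X p)
                   (Y-appears : ∀ t u v → Y t u v → Appears G X t u v)
                   (Z : Pos T → Subset n) (Γ Δ : Pos T → Rel n) where

  open Global G X td W Y W⊆X W∉parent Y-appears

  ZAgrees : Pos T → Set
  ZAgrees t = (λ v → v ∈ Z t) ≃ Zᵍ t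

  Z-step : ∀ {c p} → ChildOf c p → ZAgrees p → (λ v → v ∈ (Z p ∪ W c) ∩ X c) ≃ Zᵍ c
  Z-step {c} {p} ch e = ≃-trans (∈∪∩ (Z p) (W c) (X c) e) (Z-child ch)

  Γ-step : ∀ {t t' t''} (c₁ : ChildOf t' t) (c₂ : ChildOf t'' t) (ne : t' ≢ t'')
         → ZAgrees t → Γ t' ≐ᴿ Γᵍ t' → Γ t'' ≐ᴿ Γᵍ t''
         → proj (X t) (TC (λ w → w ∈ Z t) ((Γ t' ∪ᴿ Γ t'') ∪ᴿ Y t)) ≐ᴿ Γᵍ t
  Γ-step c₁ c₂ ne ze e₁ e₂ =
    ≐-trans (projTC-cong ze (∪-cong (∪-cong e₁ e₂) ≐-refl)) (≐-sym (ΓRecursion.Γ-recursion c₁ c₂ ne))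

  Δ-step : ∀ {t p} (ch : ChildOf t p) → ZAgrees t → Δ p ≐ᴿ Δᵍ p → Γ t ≐ᴿ Γᵍ t
         → proj (X t) (TC (λ w → w ∈ Z t) (Δ p ∪ᴿ Γ t)) ≐ᴿ Δᵍ t
  Δ-step ch ze e₁ e₂ = ≐-trans (projTC-cong ze (∪-cong e₁ e₂)) (≐-sym (ΔRecursion.Δ-recursion ch))

  localToGlobal : LocalConn X W Y Z Γ Δ → GlobalConn G X W Y Z Γ Δ
  localToGlobal (LZ , LΓ , LΔ) = Zs , Γs , Δs
    where
    Zs : ∀ t → ZAgrees t
    Zs = topDown ZAgrees (≃-trans (proj₁ (LZ root) refl) Z-root)
                         (λ {c} {p} ch ih → ≃-trans (proj₂ (LZ c) p ch) (Z-step ch ih))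
    Γs : ∀ t → Γ t ≐ᴿ Γᵍ t
    Γs = bottomUp (λ t → Γ t ≐ᴿ Γᵍ t) fromChildren
      where
      fromChildren : ∀ t → (∀ c → ChildOf c t → Γ c ≐ᴿ Γᵍ c) → Γ t ≐ᴿ Γᵍ t
      fromChildren t ih with leafOrTwo t
      ... | inj₁ lf = ≐-trans (proj₁ (LΓ t) lf) (≐-sym (Γ-leaf t lf))
      ... | inj₂ (a , b , ca , cb , ne) =
            ≐-trans (proj₂ (LΓ t) a b ca cb ne) (Γ-step ca cb ne (Zs t) (ih a ca) (ih b cb))
    Δs : ∀ t → Δ t ≐ᴿ Δᵍ t
    Δs = topDown (λ t → Δ t ≐ᴿ Δᵍ t)
                 (≐-trans (proj₁ (LΔ root) refl) (≐-trans (Γs root) (≐-sym Δ-root)))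
                 (λ {c} {p} ch ih → ≐-trans (proj₂ (LΔ c) p ch) (Δ-step ch (Zs c) ih (Γs c)))

  globalToLocal : GlobalConn G X W Y Z Γ Δ → LocalConn X W Y Z Γ Δ
  globalToLocal (Zs , Γs , Δs) =
      (λ t → (λ { refl → ≃-trans (Zs root) (≃-sym Z-root) })
           , (λ p ch → ≃-trans (Zs t) (≃-sym (Z-step ch (Zs p)))))
    , (λ t → (λ lf → ≐-trans (Γs t) (Γ-leaf t lf))
           , (λ a b ca cb ne → ≐-trans (Γs t) (≐-sym (Γ-step ca cb ne (Zs t) (Γs a) (Γs b)))))
    , (λ t → (λ { refl → ≐-trans (Δs root) (≐-trans Δ-root (≐-sym (Γs root))) })
           , (λ p ch → ≐-trans (Δs t) (≐-sym (Δ-step ch (Zs t) (Δs p) (Γs t)))))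

lemma9 : ∀ {n : ℕ} (G : SimpleGraph n) (T : Tree) (X : Pos T → Subset n)
    → IsTreeDecomposition G X
    → (W : Pos T → Subset n) (Y : Pos T → Rel n)
    → (∀ t v → v ∈ W t → v ∈ X t)
    → (∀ t p → ChildOf t p → ∀ v → v ∈ W t → v ∉ X p)
    → (∀ t u v → Y t u v → Appears G X t u v)
    → (∀ t u v → Y t u v → Y t v u)
    → (Z : Pos T → Subset n) (Γ Δ : Pos T → Rel n)
    → (LocalConn X W Y Z Γ Δ → GlobalConn G X W Y Z Γ Δ)
    × (GlobalConn G X W Y Z Γ Δ → LocalConn X W Y Z Γ Δ)
lemma9 G T X td W Y W⊆X W∉parent Y-appears _ Z Γ Δ =
  E.localToGlobal , E.globalToLocal
  where
  module E = Equivalence G X td W Y W⊆X W∉parent Y-appears Z Γ Δ
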